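{- Let $G$ be a simple graph on $n\ge 3$ vertices and let $H$ be a simple graph on $n$ vertices with $\theta(H)\le 3$. If $\delta(G)\ge n/2$ or $\delta_2(G)\ge n$, then $H$ is a subgraph of $G$.
   Context: The Ore-degree $\theta(H)$ of a graph $H$ is the maximum of $\deg_H(x)+\deg_H(y)$ over all edges $xy\in E(H)$ (and is $0$ if $H$ has no edges). For a graph $G$, $\delta_2(G)=\min\{\deg_G(x)+\deg_G(y): x\neq y,\ xy\notin E(G)\}$, the minimum over pairs of distinct non-adjacent vertices. -}

module Defs where

open import Data.Nat using (ℕ; _+_; _*_; _≤_)
open import Data.Fin using (Fin)
open import Data.Bool using (Bool; true; false)
open import Data.List using (List; length; filter)
open import Data.List.Base using (allFin)
open import Data.Product using (Σ; _×_)
open import Relation.Binary.PropositionalEquality using (_≡_; _≢_)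
open import Relation.Nullary using (¬_)
open import Data.Bool.Properties using (T?)
open import Data.Bool using (T)
open import Function.Definitions using (Injective)

record SimpleGraph (n : ℕ) : Set where
  field
    adj   : Fin n → Fin n → Bool
    sym   : ∀ x y → adj x y ≡ adj y x
    irrfl : ∀ x → adj x x ≡ false
open SimpleGraph public

Adj : ∀ {n} → SimpleGraph n → Fin n → Fin n → Set
Adj G x y = T (adj G x y)

deg : ∀ {n} → SimpleGraph n → Fin n → ℕ
deg {n} G x = length (filter (λ y → T? (adj G x y)) (allFin n))

OreDegreeAtMost : ∀ {n} → SimpleGraph n → ℕ → Set
OreDegreeAtMost H k = ∀ x y → Adj H x y → deg H x + deg H y ≤ k

-- δ(G) ≥ n/2, written as 2·deg(v) ≥ n for every vertex v
MinDegreeAtLeastHalf : ∀ {n} → SimpleGraph n → Set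
MinDegreeAtLeastHalf {n} G = ∀ x → n ≤ 2 * deg G x

-- δ₂(G) ≥ n : every pair of distinct non-adjacent vertices has degree sum ≥ n
-- (vacuous when there is no such pair, i.e. min over ∅ = ∞)
Delta2AtLeast : ∀ {n} → SimpleGraph n → ℕ → Set
Delta2AtLeast G k = ∀ x y → x ≢ y → ¬ Adj G x y → k ≤ deg G x + deg G y

IsSubgraphOf : ∀ {m n} → SimpleGraph m → SimpleGraph n → Set
IsSubgraphOf {m} {n} H G =
  Σ (Fin m → Fin n) λ f → Injective _≡_ _≡_ f × (∀ x y → Adj H x y → Adj G (f x) (f y))

module Submission where

-- Since δ(G) ≥ n/2 implies δ₂(G) ≥ n, assume δ₂(G) ≥ n.  Then G has a
-- Hamiltonian path: a duplicate-free path missing a vertex can always be extended,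
-- either at an end, or, when both ends have all their neighbours on the path, by
-- closing it into a cycle (Ore's crossing argument) and re-opening the cycle next
-- to an outside vertex (which has a neighbour on the path, again by δ₂ ≥ n).  On
-- the other side, θ(H) ≤ 3 forces every component of H to be K₁, K₂ or P₃, so the
-- vertices of H can be listed such that every edge joins consecutive entries.
-- Sending the i-th entry of that list to the i-th vertex of the Hamiltonian path
-- embeds H into G.

open import Defs hiding (sym)
open import Data.Nat using (ℕ; zero; suc; _+_; _*_; _∸_; _≤_; _<_; z≤n; s≤s)
open import Data.Nat.Properties
  using (≤-trans; ≤-antisym; +-identityʳ; m≤n⇒m≤1+n; ≤-reflexive; <-irrefl; n<1+n; 1+n≰n; m≤n+m; +-suc; +-mono-≤;
         +-cancelʳ-≤; *-cancelˡ-≤; *-distribˡ-+; m∸n+n≡m; suc-injective; module ≤-Reasoning)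
open import Data.Fin using (Fin; zero; suc; toℕ; cast; _≟_)
open import Data.Fin.Properties using (toℕ-cast; toℕ-injective; toℕ<n; injective⇒≤; any?)
open import Data.Bool using (Bool; true; false; T)
open import Data.Bool.Properties using (T?)
open import Data.List using (List; []; _∷_; _++_; [_]; length; lookup; filter; allFin; reverse)
open import Data.List.Properties using (length-++; length-tabulate; unfold-reverse)
open import Data.List.Relation.Unary.All as All using ([]; _∷_)
open import Data.List.Relation.Unary.All.Properties.Core using (¬Any⇒All¬)
open import Data.List.Relation.Unary.Any using (here; there; index)
open import Data.List.Relation.Unary.Any.Properties using (lookup-index)
open import Data.List.Relation.Unary.AllPairs using ([]; _∷_)
open import Data.List.Relation.Unary.Unique.Propositional using (Unique)
open import Data.List.Relation.Unary.Unique.Propositional.Properties using (filter⁺; allFin⁺; ++⁺)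
open import Data.List.Membership.Propositional using (_∈_; _∉_)
open import Data.List.Membership.Propositional.Properties
  using (∈-lookup; ∈-filter⁺; ∈-filter⁻; ∈-allFin; ∈-++⁻; ∈-++⁺ˡ; ∈-++⁺ʳ; ∈-∃++)
open import Data.List.Relation.Binary.Subset.Propositional using (_⊆_)
open import Data.List.Relation.Binary.Permutation.Propositional using (_↭_; refl; prep; ↭-sym; ↭-trans; ↭⇒↭ₛ)
open import Data.List.Relation.Binary.Permutation.Propositional.Properties
  using (↭-length; ++-comm; ++⁺ˡ; ∷↭∷ʳ; ↭-reverse; ∈-resp-↭)
import Data.List.Relation.Binary.Permutation.Setoid.Properties as SetoidPermutation
open import Relation.Binary.PropositionalEquality as ≡
  using (_≡_; _≢_; refl; sym; trans; cong; subst; module ≡-Reasoning)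
open import Function using (_∘′_)
open import Function.Definitions using (Injective)
open import Data.Empty using (⊥; ⊥-elim)
open import Data.Sum using (_⊎_; inj₁; inj₂) renaming (map to ⊎-map)
open import Data.Product using (Σ-syntax; ∃; ∃₂; _×_; _,_; proj₂)
open import Relation.Nullary using (¬_; yes; no; ¬?)
open import Relation.Nullary.Decidable using (_×-dec_; decidable-stable)

module Lists {A : Set} where

  lookup-injective : {xs : List A} → Unique xs → ∀ i j → lookup xs i ≡ lookup xs j → i ≡ j
  lookup-injective (_ ∷ _) zero zero _ = refl
  lookup-injective (x∉xs ∷ _) zero (suc j) eq = ⊥-elim (All.lookup x∉xs (∈-lookup j) eq)
  lookup-injective (x∉xs ∷ _) (suc i) zero eq = ⊥-elim (All.lookup x∉xs (∈-lookup i) (sym eq))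
  lookup-injective (_ ∷ u) (suc i) (suc j) eq = cong suc (lookup-injective u i j eq)

  ⊆-length : {xs ys : List A} → Unique xs → xs ⊆ ys → length xs ≤ length ys
  ⊆-length {xs} {ys} u xs⊆ys = injective⇒≤ position-injective
    where
    position : Fin (length xs) → Fin (length ys)
    position i = index (xs⊆ys (∈-lookup i))

    position-injective : Injective _≡_ _≡_ position
    position-injective {i} {j} eq = lookup-injective u i j (begin
      lookup xs i            ≡⟨ lookup-index (xs⊆ys (∈-lookup i)) ⟩
      lookup ys (position i) ≡⟨ cong (lookup ys) eq ⟩
      lookup ys (position j) ≡⟨ sym (lookup-index (xs⊆ys (∈-lookup j))) ⟩
      lookup xs j            ∎)
      where open ≡-Reasoning

  unique-↭ : {xs ys : List A} → xs ↭ ys → Unique xs → Unique ys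
  unique-↭ σ = SetoidPermutation.Unique-resp-↭ (≡.setoid A) (↭⇒↭ₛ σ)

  length≤1-∈ : {xs : List A} {a b : A} → length xs ≤ 1 → a ∈ xs → b ∈ xs → a ≡ b
  length≤1-∈ {_ ∷ []} _ (here a≡x) (here b≡x) = trans a≡x (sym b≡x)
  length≤1-∈ {_ ∷ []} _ (there ()) _
  length≤1-∈ {_ ∷ []} _ _ (there ())
  length≤1-∈ {_ ∷ _ ∷ _} (s≤s ()) _ _

  data Consec : List A → A → A → Set where
    here  : ∀ {x y xs} → Consec (x ∷ y ∷ xs) x y
    there : ∀ {w x y xs} → Consec xs x y → Consec (w ∷ xs) x y

  consec-++ˡ : ∀ {xs ys x y} → Consec xs x y → Consec (xs ++ ys) x y
  consec-++ˡ here = here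
  consec-++ˡ (there c) = there (consec-++ˡ c)

  consec-++ʳ : ∀ xs {ys x y} → Consec ys x y → Consec (xs ++ ys) x y
  consec-++ʳ [] c = c
  consec-++ʳ (_ ∷ xs) c = there (consec-++ʳ xs c)

  consec-∈ˡ : ∀ {xs x y} → Consec xs x y → x ∈ xs
  consec-∈ˡ here = here refl
  consec-∈ˡ (there c) = there (consec-∈ˡ c)

  consec-∈ʳ : ∀ {xs x y} → Consec xs x y → y ∈ xs
  consec-∈ʳ here = there (here refl)
  consec-∈ʳ (there c) = there (consec-∈ʳ c)

  consec-positions : ∀ {xs x y} → Consec xs x y →
    ∃₂ λ i j → lookup xs i ≡ x × lookup xs j ≡ y × toℕ j ≡ suc (toℕ i)
  consec-positions here = zero , suc zero , refl , refl , refl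
  consec-positions (there c) with consec-positions c
  ... | i , j , xᵢ , yⱼ , j≡1+i = suc i , suc j , xᵢ , yⱼ , cong suc j≡1+i

  lookup-consec : ∀ xs (i j : Fin (length xs)) → toℕ j ≡ suc (toℕ i) →
    Consec xs (lookup xs i) (lookup xs j)
  lookup-consec (_ ∷ _ ∷ _) zero (suc zero) _ = here
  lookup-consec (_ ∷ xs) (suc i) (suc j) j≡1+i = there (lookup-consec xs i j (suc-injective j≡1+i))
  lookup-consec (_ ∷ _) zero zero ()
  lookup-consec (_ ∷ _ ∷ _) zero (suc (suc _)) ()

open Lists

module Transfer {A B : Set} {xs : List A} {ys : List B}
                (enum : ∀ a → a ∈ xs) (same : length xs ≡ length ys) where

  position : A → Fin (length ys)
  position a = cast same (index (enum a))

  transfer : A → B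
  transfer a = lookup ys (position a)

  toℕ-position : ∀ a → toℕ (position a) ≡ toℕ (index (enum a))
  toℕ-position a = toℕ-cast same (index (enum a))

  transfer-injective : Unique ys → Injective _≡_ _≡_ transfer
  transfer-injective u {a} {b} eq = begin
    a                         ≡⟨ lookup-index (enum a) ⟩
    lookup xs (index (enum a)) ≡⟨ cong (lookup xs) same-index ⟩
    lookup xs (index (enum b)) ≡⟨ sym (lookup-index (enum b)) ⟩
    b                         ∎
    where
    open ≡-Reasoning
    same-index : index (enum a) ≡ index (enum b)
    same-index = toℕ-injective (begin
      toℕ (index (enum a)) ≡⟨ sym (toℕ-position a) ⟩
      toℕ (position a)     ≡⟨ cong toℕ (lookup-injective u _ _ eq) ⟩
      toℕ (position b)     ≡⟨ toℕ-position b ⟩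
      toℕ (index (enum b)) ∎)

  transfer-consec : Unique xs → ∀ {a b} → Consec xs a b → Consec ys (transfer a) (transfer b)
  transfer-consec u {a} {b} c with consec-positions c
  ... | i , j , xᵢ , xⱼ , j≡1+i = lookup-consec ys (position a) (position b) (begin
    toℕ (position b)           ≡⟨ toℕ-position b ⟩
    toℕ (index (enum b))       ≡⟨ cong toℕ (index-of xⱼ) ⟩
    toℕ j                      ≡⟨ j≡1+i ⟩
    suc (toℕ i)                ≡⟨ cong (suc ∘′ toℕ) (sym (index-of xᵢ)) ⟩
    suc (toℕ (index (enum a))) ≡⟨ cong suc (sym (toℕ-position a)) ⟩
    suc (toℕ (position a))     ∎)
    where
    open ≡-Reasoning
    index-of : ∀ {k e} → lookup xs k ≡ e → index (enum e) ≡ k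
    index-of {k} {e} refl = lookup-injective u _ k (sym (lookup-index (enum e)))

module GraphFacts {n : ℕ} (G : SimpleGraph n) where
  open import Data.List.Membership.DecPropositional (_≟_ {n}) using (_∈?_)

  adj-sym : ∀ {x y} → Adj G x y → Adj G y x
  adj-sym {x} {y} = subst T (SimpleGraph.sym G x y)

  adj-irrefl : ∀ {x} → ¬ Adj G x x
  adj-irrefl {x} = subst T (irrfl G x)

  adj⇒≢ : ∀ {x y} → Adj G x y → x ≢ y
  adj⇒≢ xy refl = adj-irrefl xy

  neighbours : Fin n → List (Fin n)
  neighbours v = filter (λ y → T? (adj G v y)) (allFin n)

  neighbours-unique : ∀ v → Unique (neighbours v)
  neighbours-unique v = filter⁺ (λ y → T? (adj G v y)) (allFin⁺ n)

  ∈-neighbours⁻ : ∀ {v y} → y ∈ neighbours v → Adj G v y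
  ∈-neighbours⁻ {v} y∈ = proj₂ (∈-filter⁻ (λ y → T? (adj G v y)) {xs = allFin n} y∈)

  ∈-neighbours⁺ : ∀ {v y} → Adj G v y → y ∈ neighbours v
  ∈-neighbours⁺ {v} {y} vy = ∈-filter⁺ (λ y → T? (adj G v y)) (∈-allFin y) vy

  adj⇒deg≥1 : ∀ {v y} → Adj G v y → 1 ≤ deg G v
  adj⇒deg≥1 vy = nonempty (∈-neighbours⁺ vy)
    where
    nonempty : ∀ {y} {ys : List (Fin n)} → y ∈ ys → 1 ≤ length ys
    nonempty (here _) = s≤s z≤n
    nonempty (there _) = s≤s z≤n

  length-allFin : length (allFin n) ≡ n
  length-allFin = length-tabulate {n = n} (λ x → x)

  unique⇒length≤n : ∀ {xs} → Unique xs → length xs ≤ n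
  unique⇒length≤n {xs} u =
    subst (length xs ≤_) length-allFin (⊆-length {ys = allFin n} u (λ {x} _ → ∈-allFin x))

  covering⇒n≤length : ∀ {xs} → (∀ x → x ∈ xs) → n ≤ length xs
  covering⇒n≤length {xs} cover =
    subst (_≤ length xs) length-allFin (⊆-length (allFin⁺ n) (λ {x} _ → cover x))

  count : (Fin n → Bool) → List (Fin n) → ℕ
  count f xs = length (filter (λ y → T? (f y)) xs)

  count-self : ∀ v xs → count (adj G v) (v ∷ xs) ≡ count (adj G v) xs
  count-self v xs rewrite irrfl G v = refl

  deg≤count : ∀ {v xs} → (∀ y → Adj G v y → y ∈ xs) → deg G v ≤ count (adj G v) xs
  deg≤count {v} inside = ⊆-length (neighbours-unique v)
    (λ y∈ → ∈-filter⁺ (λ y → T? (adj G v y)) (inside _ (∈-neighbours⁻ y∈)) (∈-neighbours⁻ y∈))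

  missingVertex : ∀ xs → (∃ λ z → z ∉ xs) ⊎ (∀ z → z ∈ xs)
  missingVertex xs with any? (λ z → ¬? (z ∈? xs))
  ... | yes found = inj₁ found
  ... | no none = inj₂ (λ z → decidable-stable (z ∈? xs) (λ z∉ → none (z , z∉)))

  outsideNeighbour : ∀ v xs → (∃ λ y → Adj G v y × y ∉ xs) ⊎ (∀ y → Adj G v y → y ∈ xs)
  outsideNeighbour v xs with any? (λ y → T? (adj G v y) ×-dec ¬? (y ∈? xs))
  ... | yes found = inj₁ found
  ... | no none = inj₂ (λ y vy → decidable-stable (y ∈? xs) (λ y∉ → none (y , vy , y∉)))

  neighbourOn : ∀ z xs → (∃ λ c → c ∈ xs × Adj G z c) ⊎ (∀ c → c ∈ xs → ¬ Adj G z c)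
  neighbourOn z xs with any? (λ c → (c ∈? xs) ×-dec T? (adj G z c))
  ... | yes found = inj₁ found
  ... | no none = inj₂ (λ c c∈ zc → none (c , c∈ , zc))

module Paths {n : ℕ} (G : SimpleGraph n) where
  open GraphFacts G

  data Path : Fin n → Fin n → List (Fin n) → Set where
    single : ∀ {a} → Path a a [ a ]
    cons   : ∀ {x a b xs} → Adj G x a → Path a b xs → Path x b (x ∷ xs)

  append : ∀ {a b c d xs ys} → Path a b xs → Adj G b c → Path c d ys → Path a d (xs ++ ys)
  append single bc Q = cons bc Q
  append (cons xa P) bc Q = cons xa (append P bc Q)

  reverse-path : ∀ {a b xs} → Path a b xs → Path b a (reverse xs)
  reverse-path single = single
  reverse-path (cons {x} {xs = xs} xa P) =
    subst (Path _ x) (sym (unfold-reverse x xs)) (append (reverse-path P) (adj-sym xa) single)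

  start∈ : ∀ {a b xs} → Path a b xs → a ∈ xs
  start∈ single = here refl
  start∈ (cons _ _) = here refl

  end∈ : ∀ {a b xs} → Path a b xs → b ∈ xs
  end∈ single = here refl
  end∈ (cons _ P) = there (end∈ P)

  path-consec : ∀ {a b xs x y} → Path a b xs → Consec xs x y → Adj G x y
  path-consec (cons xa single) here = xa
  path-consec (cons xa (cons _ _)) here = xa
  path-consec (cons _ P) (there c) = path-consec P c

  split : ∀ {u v c} xs ys → Path u v (xs ++ c ∷ ys) →
    Path c v (c ∷ ys) × ((xs ≡ [] × u ≡ c) ⊎ (∃ λ x → Path u x xs × Adj G x c))
  split [] _ single = single , inj₁ (refl , refl)
  split [] _ (cons ua P) = cons ua P , inj₁ (refl , refl)
  split (x ∷ []) _ (cons xc single) = single , inj₂ (x , single , xc)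
  split (x ∷ []) _ (cons xc (cons ca P)) = cons ca P , inj₂ (x , single , xc)
  split (x ∷ x′ ∷ xs) ys (cons xx′ P) with split (x′ ∷ xs) ys P
  ... | Pc , inj₂ (y , Px′y , yc) = Pc , inj₂ (y , cons xx′ Px′y , yc)

  SpanningPathFrom : Fin n → List (Fin n) → Set
  SpanningPathFrom c p = Σ[ R ∈ List (Fin n) ] Σ[ w ∈ Fin n ] (Path c w R × R ↭ p)

  Cycle : List (Fin n) → Set
  Cycle p = Σ[ C ∈ List (Fin n) ] Σ[ u ∈ Fin n ] Σ[ v ∈ Fin n ] (Path u v C × Adj G v u × C ↭ p)

  reopen : ∀ {p c} → Cycle p → c ∈ p → SpanningPathFrom c p
  reopen {p} {c} (C , u , v , P , vu , C↭p) c∈p with ∈-∃++ (∈-resp-↭ (↭-sym C↭p) c∈p)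
  ... | xs , ys , refl with split xs ys P
  ...   | Pc , inj₁ (refl , refl) = _ , _ , Pc , C↭p
  ...   | Pc , inj₂ (x , Px , xc) =
    _ , _ , append Pc vu Px , ↭-trans (++-comm (c ∷ ys) xs) C↭p

module HamiltonianPath {n : ℕ} (G : SimpleGraph n) (δ₂ : Delta2AtLeast G n) where
  open GraphFacts G
  open Paths G

  -- Let h be a vertex and x ∷ q a path ending at l.  A
  -- crossing is a cut x ∷ q = P₁ ++ P₂ where P₁ ends at a neighbour of l and P₂
  -- starts at a neighbour of h.  If there is none, then every neighbour of l on the
  -- path is followed by a non-neighbour of h, which bounds the two counts.
  Crossing : (h l x : Fin n) → List (Fin n) → Set
  Crossing h l x q = Σ[ P₁ ∈ List (Fin n) ] Σ[ P₂ ∈ List (Fin n) ] Σ[ a ∈ Fin n ] Σ[ b ∈ Fin n ]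
    (x ∷ q ≡ P₁ ++ P₂ × Path x a P₁ × Path b l P₂ × Adj G l a × Adj G h b)

  NoCrossingBound : (h l x : Fin n) → List (Fin n) → Set
  NoCrossingBound h l x q = count (adj G h) q + count (adj G l) (x ∷ q) ≤ length q

  no-crossing-step : ∀ {h l x a q} → ¬ (Adj G l x × Adj G h a) →
    NoCrossingBound h l a q → NoCrossingBound h l x (a ∷ q)
  no-crossing-step {h} {l} {x} {a} {q} none bound with adj G l x | adj G h a
  ... | true  | true  = ⊥-elim (none (_ , _))
  ... | true  | false = subst (_≤ suc (length q)) (sym (+-suc _ _)) (s≤s bound)
  ... | false | true  = s≤s bound
  ... | false | false = m≤n⇒m≤1+n bound

  -- Find a crossing or establish the bound, by recursion along the path; the
  -- work is done at its first edge x a by crossing-at (the two non-trivial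
  -- clauses of crossing only expose that the tail of the path starts at a).
  crossing : ∀ h {x l q} → Path x l (x ∷ q) → Crossing h l x q ⊎ NoCrossingBound h l x q
  crossing-at : ∀ h {x a l q} → Adj G x a → Path a l (a ∷ q) →
    Crossing h l x (a ∷ q) ⊎ NoCrossingBound h l x (a ∷ q)

  crossing h {l = l} single = inj₂ (≤-reflexive (count-self l []))
  crossing h (cons xa P@single) = crossing-at h xa P
  crossing h (cons xa P@(cons _ _)) = crossing-at h xa P

  crossing-at h {x} {a} {l} xa P with T? (adj G l x) ×-dec T? (adj G h a)
  ... | yes (lx , ha) = inj₁ ([ x ] , _ , x , a , refl , single , P , lx , ha)
  ... | no none with crossing h P
  ...   | inj₁ (P₁ , P₂ , a′ , b , eq , P₁-path , P₂-path , la′ , hb) =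
    inj₁ (x ∷ P₁ , P₂ , a′ , b , cong (x ∷_) eq , cons xa P₁-path , P₂-path , la′ , hb)
  ...   | inj₂ bound = inj₂ (no-crossing-step none bound)

  -- Either
  -- h ~ l, or a crossing gives the cycle h ⋯ a l ⋯ b h; without a crossing,
  -- n ≤ deg h + deg l ≤ |q| < n.
  close : ∀ {h l q} → Path h l (h ∷ q) → Unique (h ∷ q) → h ≢ l →
    (∀ y → Adj G h y → y ∈ h ∷ q) → (∀ y → Adj G l y → y ∈ h ∷ q) → Cycle (h ∷ q)
  close {h} {l} {q} P u h≢l h-inside l-inside with T? (adj G h l)
  ... | yes hl = h ∷ q , h , l , P , adj-sym hl , refl
  ... | no ¬hl with crossing h P
  ...   | inj₁ (P₁ , P₂ , a , b , eq , P₁-path , P₂-path , la , hb) =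
    P₁ ++ reverse P₂ , h , b , append P₁-path (adj-sym la) (reverse-path P₂-path) , adj-sym hb ,
    subst (P₁ ++ reverse P₂ ↭_) (sym eq) (++⁺ˡ P₁ (↭-reverse P₂))
  ...   | inj₂ bound = ⊥-elim (<-irrefl refl n<n)
    where
    open ≤-Reasoning
    n<n : n < n
    n<n = begin-strict
      n                                           ≤⟨ δ₂ h l h≢l ¬hl ⟩
      deg G h + deg G l                           ≤⟨ +-mono-≤ deg-h (deg≤count l-inside) ⟩
      count (adj G h) q + count (adj G l) (h ∷ q) ≤⟨ bound ⟩
      length q                                    <⟨ n<1+n _ ⟩
      length (h ∷ q)                              ≤⟨ unique⇒length≤n u ⟩
      n                                           ∎
      where
      deg-h : deg G h ≤ count (adj G h) q
      deg-h = subst (deg G h ≤_) (count-self h q) (deg≤count h-inside)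

  every-vertex-starts : ∀ {h l p c} → Path h l p → Unique p →
    (∀ y → Adj G h y → y ∈ p) → (∀ y → Adj G l y → y ∈ p) → c ∈ p → SpanningPathFrom c p
  every-vertex-starts single _ _ _ (here refl) = _ , _ , single , refl
  every-vertex-starts P@(cons _ rest) u@(h∉rest ∷ _) h-inside l-inside c∈p =
    reopen (close P u (All.lookup h∉rest (end∈ rest)) h-inside l-inside) c∈p

  -- A vertex z off the path with no neighbour on it, together with a vertex h of
  -- the path whose neighbours all lie on it, violates δ₂ ≥ n: the vertex z and
  -- the neighbourhoods of h and z are pairwise disjoint, so deg h + deg z < n.
  detached : ∀ {h z p} → h ∈ p → (∀ y → Adj G h y → y ∈ p) → z ∉ p →
    (∀ c → c ∈ p → ¬ Adj G z c) → ⊥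
  detached {h} {z} {p} h∈p h-inside z∉p z-outside = 1+n≰n (begin
    suc (deg G h + deg G z)               ≡⟨ cong suc (sym (length-++ (neighbours h))) ⟩
    length (z ∷ neighbours h ++ neighbours z) ≤⟨ unique⇒length≤n all-distinct ⟩
    n                                     ≤⟨ δ₂ h z h≢z (z-outside h h∈p ∘′ adj-sym) ⟩
    deg G h + deg G z                     ∎)
    where
    open ≤-Reasoning
    h≢z : h ≢ z
    h≢z refl = z∉p h∈p
    disjoint : ∀ {y} → ¬ (y ∈ neighbours h × y ∈ neighbours z)
    disjoint (y∈Nh , y∈Nz) =
      z-outside _ (h-inside _ (∈-neighbours⁻ y∈Nh)) (∈-neighbours⁻ y∈Nz)
    z∉N : z ∉ neighbours h ++ neighbours z
    z∉N z∈ with ∈-++⁻ (neighbours h) z∈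
    ... | inj₁ z∈Nh = z∉p (h-inside z (∈-neighbours⁻ z∈Nh))
    ... | inj₂ z∈Nz = adj-irrefl (∈-neighbours⁻ z∈Nz)
    all-distinct : Unique (z ∷ neighbours h ++ neighbours z)
    all-distinct = ¬Any⇒All¬ _ z∉N ∷ ++⁺ (neighbours-unique h) (neighbours-unique z) disjoint

  Extension : List (Fin n) → Set
  Extension p = Σ[ y ∈ Fin n ] (y ∉ p × Σ[ q ∈ List (Fin n) ] (q ↭ y ∷ p ×
                  Σ[ a ∈ Fin n ] Σ[ b ∈ Fin n ] Path a b q))

  -- A duplicate-free path missing some vertex z can be extended: through an
  -- outside neighbour of an end, or, if both ends keep their neighbours on the
  -- path, by re-opening it at a neighbour of z (which exists by `detached`).
  extend : ∀ {h l p z} → Path h l p → Unique p → z ∉ p → Extension p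
  extend {h} {l} {p} {z} P u z∉p with outsideNeighbour h p
  ... | inj₁ (y , hy , y∉p) = y , y∉p , y ∷ p , refl , y , l , cons (adj-sym hy) P
  ... | inj₂ h-inside with outsideNeighbour l p
  ...   | inj₁ (y , ly , y∉p) =
    y , y∉p , p ++ [ y ] , ↭-sym (∷↭∷ʳ y p) , h , y , append P ly single
  ...   | inj₂ l-inside with neighbourOn z p
  ...     | inj₂ z-outside = ⊥-elim (detached (start∈ P) h-inside z∉p z-outside)
  ...     | inj₁ (c , c∈p , zc) with every-vertex-starts P u h-inside l-inside c∈p
  ...       | R , w , R-path , R↭p = z , z∉p , z ∷ R , prep z R↭p , z , w , cons zc R-path

  SpanningPath : Set
  SpanningPath = Σ[ p ∈ List (Fin n) ] (Unique p × length p ≡ n × Σ[ h ∈ Fin n ] Σ[ l ∈ Fin n ] Path h l p)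

  grow : ∀ k {h l p} → Path h l p → Unique p → k + length p ≡ n → SpanningPath
  grow zero P u eq = _ , u , eq , _ , _ , P
  grow (suc k) {p = p} P u eq with missingVertex p
  ... | inj₂ all-in = ⊥-elim (1+n≰n (begin
    suc (k + length p) ≡⟨ eq ⟩
    n                  ≤⟨ covering⇒n≤length all-in ⟩
    length p           ≤⟨ m≤n+m (length p) k ⟩
    k + length p       ∎))
    where open ≤-Reasoning
  ... | inj₁ (z , z∉p) with extend P u z∉p
  ...   | y , y∉p , q , q↭y∷p , _ , _ , Q =
    grow k Q (unique-↭ (↭-sym q↭y∷p) (¬Any⇒All¬ p y∉p ∷ u)) (begin
      k + length q       ≡⟨ cong (k +_) (↭-length q↭y∷p) ⟩
      k + suc (length p) ≡⟨ +-suc k (length p) ⟩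
      suc k + length p   ≡⟨ eq ⟩
      n                  ∎)
    where open ≡-Reasoning

  spanningPath : Fin n → SpanningPath
  spanningPath v = grow (n ∸ 1) (single {v}) ([] ∷ []) (m∸n+n≡m 1≤n)
    where
    1≤n : 1 ≤ n
    1≤n = ≤-trans (s≤s z≤n) (toℕ<n v)

module Layouts {n : ℕ} (H : SimpleGraph n) where
  open GraphFacts H

  EdgesConsecutive : List (Fin n) → Set
  EdgesConsecutive K = ∀ x y → x ∈ K → Adj H x y → Consec K x y ⊎ Consec K y x

  Layout : List (Fin n) → Set
  Layout K = Unique K × EdgesConsecutive K

  consecutive⇒closed : ∀ {K x y} → EdgesConsecutive K → x ∈ K → Adj H x y → y ∈ K
  consecutive⇒closed edges x∈K xy with edges _ _ x∈K xy
  ... | inj₁ xy-consec = consec-∈ʳ xy-consec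
  ... | inj₂ yx-consec = consec-∈ˡ yx-consec

  layout⇒subgraph : ∀ (G : SimpleGraph n) {q p h l} → Layout q → (∀ x → x ∈ q) →
    Paths.Path G h l p → Unique p → length p ≡ n → IsSubgraphOf H G
  layout⇒subgraph G {q} {p} (q-unique , q-edges) enum P p-unique p-length =
    transfer , transfer-injective p-unique , edge
    where
    open Paths G using (path-consec)
    open GraphFacts G using () renaming (adj-sym to adjG-sym)
    q-length : length q ≡ n
    q-length = ≤-antisym (unique⇒length≤n q-unique) (covering⇒n≤length enum)
    open Transfer {ys = p} enum (trans q-length (sym p-length))
    edge : ∀ x y → Adj H x y → Adj G (transfer x) (transfer y)
    edge x y xy with q-edges x y (enum x) xy
    ... | inj₁ xy-consec = path-consec P (transfer-consec q-unique xy-consec)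
    ... | inj₂ yx-consec = adjG-sym (path-consec P (transfer-consec q-unique yx-consec))

-- A graph H with θ(H) ≤ 3 is a disjoint union of copies of K₁, K₂ and P₃, so it
-- has a layout listing all of its vertices.
module LinearLayout {n : ℕ} (H : SimpleGraph n) (θ : OreDegreeAtMost H 3) where
  open GraphFacts H
  open Layouts H
  open import Data.List.Membership.DecPropositional (_≟_ {n}) using (_∈?_)

  not-crowded : ∀ {x y} → Adj H x y → ¬ 3 ≤ deg H x
  not-crowded {x} {y} xy 3≤deg = 1+n≰n (≤-trans (+-mono-≤ 3≤deg (adj⇒deg≥1 (adj-sym xy))) (θ x y xy))

  fork-leaf : ∀ {x y w} → deg H x ≡ 2 → Adj H x y → Adj H y w → w ≡ x
  fork-leaf {x} {y} deg≡2 xy yw = length≤1-∈ deg-y≤1 (∈-neighbours⁺ yw) (∈-neighbours⁺ (adj-sym xy))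
    where
    deg-y≤1 : deg H y ≤ 1
    deg-y≤1 = +-cancelʳ-≤ 2 (deg H y) 1
      (subst (λ d → deg H y + d ≤ 3) deg≡2 (θ y x (adj-sym xy)))

  data Shape (x : Fin n) : Set where
    isolated : (∀ y → ¬ Adj H x y) → Shape x
    leaf     : ∀ y → Adj H x y → (∀ w → Adj H x w → w ≡ y) → Shape x
    fork     : ∀ y z → y ≢ z → Adj H x y → Adj H x z → (∀ w → Adj H x w → w ≡ y ⊎ w ≡ z) →
               deg H x ≡ 2 → Shape x

  shape : ∀ x → Shape x
  shape x = from-list (neighbours x) (neighbours-unique x) ∈-neighbours⁻ ∈-neighbours⁺ refl
    where
    from-list : ∀ L → Unique L → (∀ {w} → w ∈ L → Adj H x w) → (∀ {w} → Adj H x w → w ∈ L) →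
                length L ≡ deg H x → Shape x
    from-list [] _ _ complete _ = isolated (λ y xy → case-∅ (complete xy))
      where
      case-∅ : ∀ {y} → ¬ y ∈ []
      case-∅ ()
    from-list (y ∷ []) _ sound complete _ = leaf y (sound (here refl)) only
      where
      only : ∀ w → Adj H x w → w ≡ y
      only w xw with complete xw
      ... | here w≡y = w≡y
    from-list (y ∷ z ∷ []) ((y≢z ∷ []) ∷ _) sound complete len =
      fork y z y≢z (sound (here refl)) (sound (there (here refl))) only (sym len)
      where
      only : ∀ w → Adj H x w → w ≡ y ⊎ w ≡ z
      only w xw with complete xw
      ... | here w≡y = inj₁ w≡y
      ... | there (here w≡z) = inj₂ w≡z
    from-list (y ∷ _ ∷ _ ∷ _) _ sound _ len =
      ⊥-elim (not-crowded (sound (here refl)) (subst (3 ≤_) len (s≤s (s≤s (s≤s z≤n)))))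

  singleton-layout : ∀ {x} → (∀ y → ¬ Adj H x y) → Layout [ x ]
  singleton-layout none = [] ∷ [] , λ { _ y (here refl) xy → ⊥-elim (none y xy) }

  edge-layout : ∀ {x y} → Adj H x y → (∀ w → Adj H x w → w ≡ y) → (∀ w → Adj H y w → w ≡ x) →
    Layout (x ∷ y ∷ [])
  edge-layout {x} {y} xy only-y only-x = ((adj⇒≢ xy ∷ []) ∷ [] ∷ []) , edges
    where
    edges : EdgesConsecutive (x ∷ y ∷ [])
    edges _ w (here refl) xw with only-y w xw
    ... | refl = inj₁ here
    edges _ w (there (here refl)) yw with only-x w yw
    ... | refl = inj₂ here

  star-layout : ∀ {a y b} → a ≢ b → Adj H y a → Adj H y b → (∀ w → Adj H y w → w ≡ a ⊎ w ≡ b) →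
    deg H y ≡ 2 → Layout (a ∷ y ∷ b ∷ [])
  star-layout {a} {y} {b} a≢b ya yb only deg≡2 = distinct , edges
    where
    distinct : Unique (a ∷ y ∷ b ∷ [])
    distinct = (adj⇒≢ (adj-sym ya) ∷ a≢b ∷ []) ∷ (adj⇒≢ yb ∷ []) ∷ [] ∷ []
    edges : EdgesConsecutive (a ∷ y ∷ b ∷ [])
    edges _ w (here refl) aw with fork-leaf deg≡2 ya aw
    ... | refl = inj₁ here
    edges _ w (there (here refl)) yw with only w yw
    ... | inj₁ refl = inj₂ here
    ... | inj₂ refl = inj₁ (there here)
    edges _ w (there (there (here refl))) bw with fork-leaf deg≡2 yb bw
    ... | refl = inj₂ (there here)

  Near : Fin n → List (Fin n) → Set
  Near x K = ∀ w → w ∈ K → w ≡ x ⊎ Adj H w x ⊎ (∃ λ y → Adj H w y × Adj H y x)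

  Component : Fin n → Set
  Component x = Σ[ K ∈ List (Fin n) ] (Layout K × x ∈ K × Near x K)

  component : ∀ x → Component x
  component x with shape x
  ... | isolated none = [ x ] , singleton-layout none , here refl , λ { _ (here refl) → inj₁ refl }
  ... | fork a b a≢b xa xb only deg≡2 =
    a ∷ x ∷ b ∷ [] , star-layout a≢b xa xb only deg≡2 , there (here refl) , near
    where
    near : Near x (a ∷ x ∷ b ∷ [])
    near _ (here refl) = inj₂ (inj₁ (adj-sym xa))
    near _ (there (here refl)) = inj₁ refl
    near _ (there (there (here refl))) = inj₂ (inj₁ (adj-sym xb))
  ... | leaf y xy only-y with shape y
  ...   | isolated none = ⊥-elim (none x (adj-sym xy))
  ...   | leaf x′ _ only-x′ = x ∷ y ∷ [] , edge-layout xy only-y only-x , here refl , near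
    where
    only-x : ∀ w → Adj H y w → w ≡ x
    only-x w yw = trans (only-x′ w yw) (sym (only-x′ x (adj-sym xy)))
    near : Near x (x ∷ y ∷ [])
    near _ (here refl) = inj₁ refl
    near _ (there (here refl)) = inj₂ (inj₁ (adj-sym xy))
  ...   | fork a b a≢b ya yb only deg≡2 =
    a ∷ y ∷ b ∷ [] , star-layout a≢b ya yb only deg≡2 , x∈ (only x (adj-sym xy)) , near
    where
    x∈ : x ≡ a ⊎ x ≡ b → x ∈ a ∷ y ∷ b ∷ []
    x∈ (inj₁ x≡a) = here x≡a
    x∈ (inj₂ x≡b) = there (there (here x≡b))
    near : Near x (a ∷ y ∷ b ∷ [])
    near _ (here refl) = inj₂ (inj₂ (y , adj-sym ya , adj-sym xy))
    near _ (there (here refl)) = inj₂ (inj₁ (adj-sym xy))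
    near _ (there (there (here refl))) = inj₂ (inj₂ (y , adj-sym yb , adj-sym xy))

  -- Appending the component K of a vertex x missing from a layout acc gives a
  -- layout: acc is closed under adjacency and every entry of K is near x, so an
  -- entry shared by acc and K would put x into acc.
  append-component : ∀ {acc K x} → Layout acc → x ∉ acc → Layout K → Near x K → Layout (acc ++ K)
  append-component {acc} {K} {x} (acc-unique , acc-edges) x∉acc (K-unique , K-edges) near =
    ++⁺ acc-unique K-unique disjoint , edges
    where
    closed : ∀ {u v} → u ∈ acc → Adj H u v → v ∈ acc
    closed = consecutive⇒closed acc-edges
    disjoint : ∀ {w} → ¬ (w ∈ acc × w ∈ K)
    disjoint {w} (w∈acc , w∈K) with near w w∈K
    ... | inj₁ refl = x∉acc w∈acc
    ... | inj₂ (inj₁ wx) = x∉acc (closed w∈acc wx)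
    ... | inj₂ (inj₂ (_ , wy , yx)) = x∉acc (closed (closed w∈acc wy) yx)
    edges : EdgesConsecutive (acc ++ K)
    edges u v u∈ uv with ∈-++⁻ acc u∈
    ... | inj₁ u∈acc = ⊎-map consec-++ˡ consec-++ˡ (acc-edges u v u∈acc uv)
    ... | inj₂ u∈K = ⊎-map (consec-++ʳ acc) (consec-++ʳ acc) (K-edges u v u∈K uv)

  collect : (L acc : List (Fin n)) → Layout acc →
    Σ[ q ∈ List (Fin n) ] (Layout q × L ⊆ q × acc ⊆ q)
  collect [] acc lay = acc , lay , (λ ()) , (λ a∈ → a∈)
  collect (x ∷ L) acc lay with x ∈? acc
  ... | yes x∈acc with collect L acc lay
  ...   | q , lay-q , L⊆q , acc⊆q =
    q , lay-q , (λ { (here refl) → acc⊆q x∈acc ; (there y∈L) → L⊆q y∈L }) , acc⊆q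
  collect (x ∷ L) acc lay | no x∉acc with component x
  ... | K , lay-K , x∈K , near with collect L (acc ++ K) (append-component lay x∉acc lay-K near)
  ...   | q , lay-q , L⊆q , acc++K⊆q =
    q , lay-q , (λ { (here refl) → acc++K⊆q (∈-++⁺ʳ acc x∈K) ; (there y∈L) → L⊆q y∈L }) ,
    (λ y∈acc → acc++K⊆q (∈-++⁺ˡ y∈acc))

  layout : Σ[ q ∈ List (Fin n) ] (Layout q × (∀ x → x ∈ q))
  layout with collect (allFin n) [] ([] , λ _ _ ())
  ... | q , lay , allFin⊆q , _ = q , lay , λ x → allFin⊆q (∈-allFin x)

half⇒δ₂ : ∀ {n} (G : SimpleGraph n) → MinDegreeAtLeastHalf G → Delta2AtLeast G n
half⇒δ₂ {n} G half x y _ _ = *-cancelˡ-≤ 2 (begin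
  2 * n                      ≡⟨ cong (n +_) (+-identityʳ n) ⟩
  n + n                      ≤⟨ +-mono-≤ (half x) (half y) ⟩
  2 * deg G x + 2 * deg G y  ≡⟨ sym (*-distribˡ-+ 2 (deg G x) (deg G y)) ⟩
  2 * (deg G x + deg G y)    ∎)
  where open ≤-Reasoning

degree-condition⇒δ₂ : ∀ {n} (G : SimpleGraph n) →
  MinDegreeAtLeastHalf G ⊎ Delta2AtLeast G n → Delta2AtLeast G n
degree-condition⇒δ₂ G (inj₁ half) = half⇒δ₂ G half
degree-condition⇒δ₂ G (inj₂ δ₂) = δ₂

theorem3 : (n : ℕ) → 3 ≤ n → (G H : SimpleGraph n) →
    OreDegreeAtMost H 3 →
    (MinDegreeAtLeastHalf G ⊎ Delta2AtLeast G n) →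
    IsSubgraphOf H G
theorem3 zero () _ _ _ _
theorem3 (suc _) _ G H θ degree-condition
  with HamiltonianPath.spanningPath G (degree-condition⇒δ₂ G degree-condition) zero
     | LinearLayout.layout H θ
... | p , p-unique , p-length , _ , _ , P | q , q-layout , enum =
  Layouts.layout⇒subgraph H G q-layout enum P p-unique p-length
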